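{- Every biordered forest with code $(\pi,p)$ induces an alternation acyclic tournament $T=T(\pi,p)$. Furthermore, the permutation $\pi$ is a linear extension of the right alternating walk order induced by $T$.
   Context: A tournament $T$ on $\{1,\ldots,n\}$ is a directed graph without loops or multiple edges in which for every pair $\{i,j\}$ exactly one of $i\rightarrow j$, $j\rightarrow i$ is an edge. An edge $i\rightarrow j$ is an ascent if $i<j$ and a descent if $i>j$. A directed cycle is alternating if ascents and descents alternate along it, and $T$ is alternation acyclic if it contains no alternating cycle. In $T$ there is a right-alternating walk from $u$ to $v$ (written $u \preceq v$) if $u=v$ or there is a directed walk $u=w_0\rightarrow w_1\rightarrow\cdots\rightarrow w_{2i}=v$ in which $w_0\rightarrow w_1$ is a descent, and descents and ascents alternate, the last edge being an ascent; $\preceq$ is the right alternating walk order induced by $T$ (it is a partial order exactly when $T$ is alternation acyclic). A biordered forest on $n$ elements is encoded by a code $(\pi,p)$, where $\pi$ is a permutation of $\{1,\ldots,n\}$ and $p:\{1,\ldots,n\}\rightarrow\{2,\ldots,n\}\cup\{\infty\}$ is a parent function satisfying $p(i)>i$ for all $i$. The tournament $T(\pi,p)$ induced by the biordered forest has vertex set $\{1,\ldots,n\}$ and, for all $u<v$, contains the ascent $u\rightarrow v$ if $p(u)\neq\infty$ and $\pi^{ -1}(v)\geq \pi^{ -1}(p(u))$, and otherwise contains the descent $v\rightarrow u$. A permutation $\pi$ is a linear extension of $\preceq$ if $u\preceq v$ implies $\pi^{ -1}(u)\leq\pi^{ -1}(v)$. -}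

module Defs where

open import Data.Nat using (ℕ; zero; suc; _*_; _%_)
open import Data.Fin using (Fin; toℕ; inject₁; fromℕ; _<_; _≤_)
open import Data.Fin.Permutation using (Permutation′; _⟨$⟩ʳ_; _⟨$⟩ˡ_)
open import Data.Maybe using (Maybe; just; nothing)
open import Data.Product using (_×_; ∃-syntax; Σ-syntax)
open import Data.Sum using (_⊎_)
open import Function.Definitions using (Injective)
open import Relation.Binary.PropositionalEquality using (_≡_; _≢_)
open import Relation.Nullary using (¬_)

-- A directed graph on the vertex set {1,…,n} is encoded as an edge
-- relation on Fin n (vertex i+1 of the paper is (i : Fin n); the natural
-- order of Fin n is the order of {1,…,n}).
Digraph : ℕ → Set₁
Digraph n = Fin n → Fin n → Set

IsTournament : ∀ {n} → Digraph n → Set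
IsTournament {n} E =
  (∀ (u : Fin n) → ¬ E u u) ×
  (∀ (u v : Fin n) → u ≢ v → E u v ⊎ E v u) ×
  (∀ (u v : Fin n) → E u v → ¬ E v u)

AscentEdge : ∀ {n} → Digraph n → Fin n → Fin n → Set
AscentEdge E a b = E a b × a < b

DescentEdge : ∀ {n} → Digraph n → Fin n → Fin n → Set
DescentEdge E a b = E a b × b < a

-- Alternating directed cycle of length 2(k+1): distinct vertices
-- c 0, …, c (2k+1) (with c (2k+2) = c 0 closing the cycle); edge number i
-- (from c i to c (i+1)) is an ascent for even i and a descent for odd i.
-- (Any alternating cycle can be rotated to start with an ascent.)
record AlternatingCycle {n} (E : Digraph n) : Set where
  field
    k      : ℕ
    c      : Fin (suc (2 * suc k)) → Fin n
    closed : c Data.Fin.zero ≡ c (fromℕ (2 * suc k))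
    distinct : Injective _≡_ _≡_ (λ (i : Fin (2 * suc k)) → c (inject₁ i))
    alt    : ∀ (i : Fin (2 * suc k)) →
               (toℕ i % 2 ≡ 0 → AscentEdge E (c (inject₁ i)) (c (Data.Fin.suc i))) ×
               (toℕ i % 2 ≡ 1 → DescentEdge E (c (inject₁ i)) (c (Data.Fin.suc i)))

AlternationAcyclic : ∀ {n} → Digraph n → Set
AlternationAcyclic E = ¬ AlternatingCycle E

-- Right-alternating walk of positive length 2(k+1) from u to v:
-- w 0 = u, w (2k+2) = v, edge number i is a descent for even i and an
-- ascent for odd i (so the first edge is a descent, the last an ascent).
record RightAltWalk {n} (E : Digraph n) (u v : Fin n) : Set where
  field
    k     : ℕ
    w     : Fin (suc (2 * suc k)) → Fin n
    start : w Data.Fin.zero ≡ u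
    end   : w (fromℕ (2 * suc k)) ≡ v
    alt   : ∀ (i : Fin (2 * suc k)) →
              (toℕ i % 2 ≡ 0 → DescentEdge E (w (inject₁ i)) (w (Data.Fin.suc i))) ×
              (toℕ i % 2 ≡ 1 → AscentEdge E (w (inject₁ i)) (w (Data.Fin.suc i)))

_⪯[_]_ : ∀ {n} → Fin n → Digraph n → Fin n → Set
u ⪯[ E ] v = u ≡ v ⊎ RightAltWalk E u v

-- Codes of biordered forests: π : Fin n ↔ Fin n maps positions to
-- elements (π(1),…,π(n)), so π⁻¹ v = π ⟨$⟩ˡ v is the position of v.
-- The parent function is p : Fin n → Maybe (Fin n), nothing = ∞,
-- required to satisfy p(i) > i.
ValidParent : ∀ {n} → (Fin n → Maybe (Fin n)) → Set
ValidParent {n} p = ∀ (i j : Fin n) → p i ≡ just j → i < j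

AscCond : ∀ {n} → Permutation′ n → (Fin n → Maybe (Fin n)) → Fin n → Fin n → Set
AscCond π p u v = ∃[ w ] (p u ≡ just w × (π ⟨$⟩ˡ w) ≤ (π ⟨$⟩ˡ v))

T : ∀ {n} → Permutation′ n → (Fin n → Maybe (Fin n)) → Digraph n
T π p a b = (a < b × AscCond π p a b) ⊎ (b < a × ¬ AscCond π p b a)

IsLinearExtension : ∀ {n} → Permutation′ n → (Fin n → Fin n → Set) → Set
IsLinearExtension {n} π R = ∀ (u v : Fin n) → R u v → (π ⟨$⟩ˡ u) ≤ (π ⟨$⟩ˡ v)

module Submission where

open import Defs
open import Data.Nat using (ℕ)
open import Data.Fin using (Fin)
open import Data.Fin.Permutation using (Permutation′)
open import Data.Maybe using (Maybe)
open import Data.Product using (_×_)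

open import Data.Nat as ℕ using (zero; suc; _*_; _%_; s≤s)
import Data.Nat.Properties as ℕ
open import Data.Nat.DivMod using (m*n%n≡0; [m+kn]%n≡m%n)
open import Data.Fin as Fin using (toℕ; inject₁; fromℕ; fromℕ<; _<_)
open import Data.Fin.Properties using (toℕ-injective; toℕ-fromℕ<; toℕ-inject₁; toℕ<n; toℕ-fromℕ; <-cmp; _≤?_)
open import Data.Fin.Permutation using (_⟨$⟩ˡ_)
open import Data.Maybe using (just; nothing)
open import Data.Product using (_,_; proj₁; proj₂)
open import Data.Sum using (_⊎_; inj₁; inj₂)
open import Function using (_∘_)
open import Relation.Nullary using (¬_; yes; no; contradiction)
open import Relation.Nullary.Decidable using (map′)
open import Relation.Binary using (Decidable; tri<; tri≈; tri>)
open import Relation.Binary.PropositionalEquality using (_≡_; _≢_; refl; sym; trans; cong; subst; subst₂)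

-- In T(π,p), a descent a → b followed by an ascent b → c forces π⁻¹(a) < π⁻¹(c):
-- the ascent gives p(b) = w with π⁻¹(w) ≤ π⁻¹(c), and the descent says exactly
-- that π⁻¹(w) ≤ π⁻¹(a) fails.  So positions strictly increase every two steps
-- along a right-alternating walk, which makes π a linear extension of ⪯, and
-- also around an alternating cycle, which is absurd.

Orient : ∀ {n} → (Fin n → Fin n → Set) → Digraph n
Orient A a b = (a < b × A a b) ⊎ (b < a × ¬ A b a)

orient-isTournament : ∀ {n} {A : Fin n → Fin n → Set} → Decidable A → IsTournament (Orient A)
orient-isTournament {A = A} A? = irreflexive , total , antisymmetric
  where
  irreflexive : ∀ u → ¬ Orient A u u
  irreflexive u (inj₁ (u<u , _)) = ℕ.<-irrefl refl u<u
  irreflexive u (inj₂ (u<u , _)) = ℕ.<-irrefl refl u<u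

  total : ∀ u v → u ≢ v → Orient A u v ⊎ Orient A v u
  total u v u≢v with <-cmp u v
  ... | tri≈ _ u≡v _ = contradiction u≡v u≢v
  ... | tri< u<v _ _ with A? u v
  ...   | yes a = inj₁ (inj₁ (u<v , a))
  ...   | no ¬a = inj₂ (inj₂ (u<v , ¬a))
  total u v u≢v | tri> _ _ v<u with A? v u
  ...   | yes a = inj₂ (inj₁ (v<u , a))
  ...   | no ¬a = inj₁ (inj₂ (v<u , ¬a))

  antisymmetric : ∀ u v → Orient A u v → ¬ Orient A v u
  antisymmetric u v (inj₁ (u<v , _)) (inj₁ (v<u , _)) = ℕ.<-asym u<v v<u
  antisymmetric u v (inj₁ (_ , a))   (inj₂ (_ , ¬a))  = ¬a a
  antisymmetric u v (inj₂ (_ , ¬a))  (inj₁ (_ , a))   = ¬a a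
  antisymmetric u v (inj₂ (v<u , _)) (inj₂ (u<v , _)) = ℕ.<-asym u<v v<u

ascCond? : ∀ {n} (π : Permutation′ n) (p : Fin n → Maybe (Fin n)) → Decidable (AscCond π p)
ascCond? π p u v with p u
... | nothing = no λ { (_ , () , _) }
... | just w  = map′ (λ le → w , refl , le) (λ { (_ , refl , le) → le }) ((π ⟨$⟩ˡ w) ≤? (π ⟨$⟩ˡ v))

module _ {n} (π : Permutation′ n) (p : Fin n → Maybe (Fin n)) where

  T-isTournament : IsTournament (T π p)
  T-isTournament = orient-isTournament (ascCond? π p)

  ascent⇒AscCond : ∀ {a b} → AscentEdge (T π p) a b → AscCond π p a b
  ascent⇒AscCond (inj₁ (_ , asc) , _)  = asc
  ascent⇒AscCond (inj₂ (b<a , _) , a<b) = contradiction b<a (ℕ.<-asym a<b)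

  descent⇒¬AscCond : ∀ {a b} → DescentEdge (T π p) a b → ¬ AscCond π p b a
  descent⇒¬AscCond (inj₁ (a<b , _) , b<a) = contradiction b<a (ℕ.<-asym a<b)
  descent⇒¬AscCond (inj₂ (_ , ¬asc) , _) = ¬asc

  descent-ascent⇒position< : ∀ {a b c} → DescentEdge (T π p) a b → AscentEdge (T π p) b c →
                             (π ⟨$⟩ˡ a) < (π ⟨$⟩ˡ c)
  descent-ascent⇒position< {a} a↘b b↗c with ascent⇒AscCond b↗c
  ... | w , pb≡w , w≤c = ℕ.<-≤-trans a<w w≤c
    where
    a<w : (π ⟨$⟩ˡ a) < (π ⟨$⟩ˡ w)
    a<w = ℕ.≰⇒> (λ w≤a → descent⇒¬AscCond a↘b (w , pb≡w , w≤a))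

-- Finite sequences indexed by Fin (suc M) are read at natural numbers, so
-- that index arithmetic happens in ℕ; out-of-range indices give the first entry.
clamp : ∀ {M} → ℕ → Fin (suc M)
clamp {M} m with m ℕ.<? suc M
... | yes m<1+M = fromℕ< m<1+M
... | no _      = Fin.zero

clamp-toℕ : ∀ {M} (x : Fin (suc M)) → clamp (toℕ x) ≡ x
clamp-toℕ {M} x with toℕ x ℕ.<? suc M
... | yes x<1+M = toℕ-injective (toℕ-fromℕ< x<1+M)
... | no  x≮1+M = contradiction (toℕ<n x) x≮1+M

module _ {A : Set} {M} (f : Fin (suc M) → A) where

  at : ℕ → A
  at = f ∘ clamp

  at-toℕ : ∀ x → f x ≡ at (toℕ x)
  at-toℕ x = cong f (sym (clamp-toℕ x))

  at-last : f (fromℕ M) ≡ at M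
  at-last = trans (at-toℕ (fromℕ M)) (cong at (toℕ-fromℕ M))

  at-step : (R : A → A → Set) (Q : ℕ → Set) →
            (∀ i → Q (toℕ i) → R (f (inject₁ i)) (f (Fin.suc i))) →
            ∀ m → m ℕ.< M → Q m → R (at m) (at (suc m))
  at-step R Q step m m<M q =
    subst₂ R (trans (at-toℕ (inject₁ i)) (cong at (trans (toℕ-inject₁ i) toℕ-i)))
             (trans (at-toℕ (Fin.suc i)) (cong (at ∘ suc) toℕ-i))
             (step i (subst Q (sym toℕ-i) q))
    where
    i = fromℕ< m<M
    toℕ-i = toℕ-fromℕ< m<M

2*j%2≡0 : ∀ j → 2 * j % 2 ≡ 0
2*j%2≡0 j = trans (cong (_% 2) (ℕ.*-comm 2 j)) (m*n%n≡0 j 2)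

1+2*j%2≡1 : ∀ j → suc (2 * j) % 2 ≡ 1
1+2*j%2≡1 j = trans (cong (λ x → suc x % 2) (ℕ.*-comm 2 j)) ([m+kn]%n≡m%n 1 j 2)

1+2*j<2*k : ∀ {j k} → j ℕ.< k → suc (2 * j) ℕ.< 2 * k
1+2*j<2*k {j} {k} j<k = subst (ℕ._≤ 2 * k) (ℕ.*-suc 2 j) (ℕ.*-monoʳ-≤ 2 j<k)

module Alternating {A : Set} {M} (f : Fin (suc M) → A) (R₀ R₁ : A → A → Set)
  (alternates : ∀ i → (toℕ i % 2 ≡ 0 → R₀ (f (inject₁ i)) (f (Fin.suc i))) ×
                      (toℕ i % 2 ≡ 1 → R₁ (f (inject₁ i)) (f (Fin.suc i)))) where

  even-step : ∀ j → 2 * j ℕ.< M → R₀ (at f (2 * j)) (at f (suc (2 * j)))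
  even-step j 2j<M = at-step f R₀ (λ m → m % 2 ≡ 0) (proj₁ ∘ alternates) (2 * j) 2j<M (2*j%2≡0 j)

  odd-step : ∀ j → suc (2 * j) ℕ.< M → R₁ (at f (suc (2 * j))) (at f (2 * suc j))
  odd-step j 1+2j<M = subst (R₁ (at f (suc (2 * j))) ∘ at f) (sym (ℕ.*-suc 2 j))
    (at-step f R₁ (λ m → m % 2 ≡ 1) (proj₂ ∘ alternates) (suc (2 * j)) 1+2j<M (1+2*j%2≡1 j))

increasing⇒≤ : (G : ℕ → ℕ) → ∀ j → (∀ i → i ℕ.< j → G i ℕ.< G (suc i)) → G 0 ℕ.≤ G j
increasing⇒≤ G zero    _  = ℕ.≤-refl
increasing⇒≤ G (suc j) up = ℕ.≤-trans (increasing⇒≤ G j (λ i i<j → up i (ℕ.m<n⇒m<1+n i<j)))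
                                      (ℕ.<⇒≤ (up j ℕ.≤-refl))

module _ {n} (π : Permutation′ n) (p : Fin n → Maybe (Fin n)) where

  private
    pos : Fin n → ℕ
    pos x = toℕ (π ⟨$⟩ˡ x)

  rightAltWalk⇒position< : ∀ {u v} → RightAltWalk (T π p) u v → (π ⟨$⟩ˡ u) < (π ⟨$⟩ˡ v)
  rightAltWalk⇒position< W =
    subst₂ (λ a b → pos a ℕ.< pos b) (trans (at-toℕ w Fin.zero) start) (trans (sym (at-last w)) end)
      (ℕ.≤-<-trans (increasing⇒≤ G k (λ i i<k → up i (ℕ.m<n⇒m<1+n i<k))) (up k ℕ.≤-refl))
    where
    open RightAltWalk W
    open Alternating w (DescentEdge (T π p)) (AscentEdge (T π p)) alt
    G : ℕ → ℕ
    G j = pos (at w (2 * j))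
    up : ∀ i → i ℕ.< suc k → G i ℕ.< G (suc i)
    up i i<1+k = descent-ascent⇒position< π p (even-step i (ℕ.<⇒≤ (1+2*j<2*k i<1+k)))
                                              (odd-step i (1+2*j<2*k i<1+k))

  T-alternationAcyclic : AlternationAcyclic (T π p)
  T-alternationAcyclic C = ℕ.<-irrefl refl (ℕ.≤-<-trans (increasing⇒≤ G k up) back-to-start)
    where
    open AlternatingCycle C
    open Alternating c (AscentEdge (T π p)) (DescentEdge (T π p)) alt
    G : ℕ → ℕ
    G j = pos (at c (suc (2 * j)))
    up : ∀ i → i ℕ.< k → G i ℕ.< G (suc i)
    up i i<k = descent-ascent⇒position< π p (odd-step i (1+2*j<2*k (ℕ.m<n⇒m<1+n i<k)))
                                            (even-step (suc i) (ℕ.<⇒≤ (1+2*j<2*k (s≤s i<k))))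
    closes : at c (2 * suc k) ≡ at c 0
    closes = trans (sym (at-last c)) (trans (sym closed) (at-toℕ c Fin.zero))
    back-to-start : G k ℕ.< G 0
    back-to-start = descent-ascent⇒position< π p
      (subst (DescentEdge (T π p) (at c (suc (2 * k)))) closes (odd-step k (1+2*j<2*k ℕ.≤-refl)))
      (even-step 0 (s≤s ℕ.z≤n))

  π-isLinearExtension : IsLinearExtension π (λ u v → u ⪯[ T π p ] v)
  π-isLinearExtension u .u (inj₁ refl) = ℕ.≤-refl
  π-isLinearExtension u v  (inj₂ W)    = ℕ.<⇒≤ (rightAltWalk⇒position< W)

theorem3p7 : ∀ (n : ℕ) (π : Permutation′ n) (p : Fin n → Maybe (Fin n)) →
    ValidParent p →
    IsTournament (T π p) × AlternationAcyclic (T π p) ×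
    IsLinearExtension π (λ u v → u ⪯[ T π p ] v)
theorem3p7 n π p _ = T-isTournament π p , T-alternationAcyclic π p , π-isLinearExtension π p
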